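{- Let $\lambda$ be a nonzero real number and $k\in\mathbb{Z}$. Define the degenerate poly-Bell polynomials of the second kind $\mathrm{bel}_{n,\lambda}^{(k)}(x)$ ($n\ge1$) by \[ \mathrm{Li}_{k,\lambda}\big(-x\log_{\lambda}(1-t)\big)=\sum_{n=1}^{\infty}\mathrm{bel}_{n,\lambda}^{(k)}(x)\frac{t^{n}}{n!}. \] Then for every $n\ge1$, \[ \frac{(-\lambda)^{n-1}(1)_{n,1/\lambda}}{n^{k-1}}x^{n}=\sum_{l=1}^{n}(-1)^{n-l}\mathrm{bel}_{l,\lambda}^{(k)}(x)S_{2,\lambda}(n,l). \]
   Context: For real $x$ and $\mu$, $(x)_{0,\mu}=1$ and $(x)_{n,\mu}=x(x-\mu)\cdots(x-(n-1)\mu)$ for $n\ge1$. The degenerate exponential is $e_\lambda(t)=\sum_{n\ge0}(1)_{n,\lambda}\frac{t^n}{n!}$ (i.e. $(1+\lambda t)^{1/\lambda}$), and the degenerate logarithm is $\log_{\lambda}(1+t)=\sum_{n=1}^{\infty}\lambda^{n-1}(1)_{n,1/\lambda}\frac{t^{n}}{n!}$ (i.e. $\frac1\lambda((1+t)^\lambda-1)$); $\log_\lambda(1-t)$ is obtained by substituting $-t$ for $t$. The degenerate polylogarithm is $\mathrm{Li}_{k,\lambda}(x)=\sum_{n=1}^{\infty}\frac{(-\lambda)^{n-1}(1)_{n,1/\lambda}}{(n-1)!\,n^{k}}x^{n}$. The degenerate Stirling numbers of the second kind are defined by $\frac{1}{l!}\big(e_{\lambda}(t)-1\big)^{l}=\sum_{n=l}^{\infty}S_{2,\lambda}(n,l)\frac{t^{n}}{n!}$.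 All series are formal power series. -}

module Defs where

open import Level using (Level; _⊔_) renaming (suc to lsuc)
open import Algebra.Bundles using (CommutativeRing)
open import Data.Nat as ℕ using (ℕ; zero; suc)
open import Data.Integer as ℤ using (ℤ; +_; -[1+_])
open import Relation.Nullary using (¬_)

natR : ∀ {c ℓ} (R : CommutativeRing c ℓ) → ℕ → CommutativeRing.Carrier R
natR R zero    = CommutativeRing.0# R
natR R (suc n) = CommutativeRing._+_ R (CommutativeRing.1# R) (natR R n)

-- A field of characteristic zero (the reals are one), encoded as a
-- commutative ring with a total inverse function that is a genuine
-- inverse on nonzero elements, and n·1 ≠ 0 for n ≥ 1.
record CharZeroField (c ℓ : Level) : Set (lsuc (c ⊔ ℓ)) where
  field
    cring : CommutativeRing c ℓ
  open CommutativeRing cring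
  field
    inv   : Carrier → Carrier
    inv-r : ∀ x → ¬ (x ≈ 0#) → x * inv x ≈ 1#
    char0 : ∀ n → ¬ (natR cring (suc n) ≈ 0#)

module Degenerate {c ℓ} (F : CharZeroField c ℓ) where
  open CharZeroField F public
  open CommutativeRing cring public

  ι : ℕ → Carrier
  ι = natR cring

  _/_ : Carrier → Carrier → Carrier
  a / b = a * inv b

  _^_ : Carrier → ℕ → Carrier
  a ^ zero  = 1#
  a ^ suc n = a * (a ^ n)

  _^ℤ_ : Carrier → ℤ → Carrier
  a ^ℤ (+ m)     = a ^ m
  a ^ℤ -[1+ m ]  = inv a ^ suc m

  fact : ℕ → Carrier
  fact n = ι (n ℕ.!)

  sumBelow : ℕ → (ℕ → Carrier) → Carrier
  sumBelow zero    f = 0#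
  sumBelow (suc n) f = sumBelow n f + f n

  -- generalized falling factorial (x)_{n,μ} = x(x-μ)⋯(x-(n-1)μ)
  ff : Carrier → Carrier → ℕ → Carrier
  ff x μ zero    = 1#
  ff x μ (suc n) = ff x μ n * (x - ι n * μ)

  -- formal power series in t: coefficient sequences
  PS : Set c
  PS = ℕ → Carrier

  oneS : PS
  oneS zero    = 1#
  oneS (suc n) = 0#

  _⊛_ : PS → PS → PS
  (f ⊛ g) n = sumBelow (suc n) (λ i → f i * g (n ℕ.∸ i))

  powS : PS → ℕ → PS
  powS g zero    = oneS
  powS g (suc m) = g ⊛ powS g m

  -- composition f(g(t)) for g with zero constant term:
  -- [t^n] f(g) = Σ_{m ≤ n} f_m [t^n] g^m  (terms with m > n vanish)
  compose : PS → PS → PS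
  compose f g n = sumBelow (suc n) (λ m → f m * powS g m n)

  module _ (lam : Carrier) where
    eλ : PS
    eλ n = ff 1# lam n / fact n

    eλ-1 : PS
    eλ-1 zero    = 0#
    eλ-1 (suc n) = eλ (suc n)

    logλ1+ : PS
    logλ1+ zero    = 0#
    logλ1+ (suc m) = (lam ^ m) * ff 1# (inv lam) (suc m) / fact (suc m)

    -- log_λ(1-t): substitute -t for t
    logλ1- : PS
    logλ1- n = ((- 1#) ^ n) * logλ1+ n

    Li : ℤ → PS
    Li k zero    = 0#
    Li k (suc m) = ((- lam) ^ m) * ff 1# (inv lam) (suc m)
                   / (fact m * (ι (suc m) ^ℤ k))

    -- degenerate Stirling numbers of the second kind:
    -- (1/l!) (e_λ(t)-1)^l = Σ_n S_{2,λ}(n,l) t^n/n!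
    S2 : ℕ → ℕ → Carrier
    S2 n l = fact n * (powS eλ-1 l n / fact l)

    bel : ℤ → Carrier → ℕ → Carrier
    bel k x n = fact n * compose (Li k) (λ m → - (x * logλ1- m)) n

-- The coefficients p(n,l) = [tⁿ] Eˡ of E = e_λ(t) − 1 and q(l,m) = [tˡ] gᵐ of
-- g = −log_λ(1 − t) form inverse matrices up to the sign (−1)ⁿ⁻ˡ, because
-- g(−E(−t)) = t. Rather than composing series, the inversion is derived from the
-- differential equations (1 + λt)E′ = 1 + E and (1 − t)g′ = 1 − λg: they give
-- first-order recurrences for the coefficients of the powers of E and of g, from
-- which Σₗ (−1)ⁿ⁻ˡ p(n,l) q(l,m) = δₙₘ follows by induction on n. Writing bel_l and
-- S_{2,λ}(n,l) through p and q, the right-hand side becomes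
-- Σₘ n! [xᵐ]Li_{k,λ} · xᵐ · δₙₘ, which is the left-hand side.

{-# OPTIONS --safe #-}
module Submission where

open import Defs
open import Level using (Level)
open import Data.Nat as ℕ using (ℕ; zero; suc; _<_; _≤_; _∸_; z≤n; s≤s)
import Data.Nat.Properties as ℕP
open import Data.Sum using (inj₁; inj₂)
open import Data.Integer as ℤ using (ℤ; +_; -[1+_])
import Data.Integer.Properties as ℤP
open import Data.Sign as Sign using (Sign)
open import Data.Maybe using (Maybe; just; nothing)
open import Relation.Nullary using (¬_; yes; no)
open import Relation.Binary.PropositionalEquality as P using (_≡_)
open import Algebra.Bundles using (CommutativeRing)
import Algebra.Properties.Ring as RingProperties
import Algebra.Properties.Semiring.Mult.TCOptimised as SemiringMult
import Algebra.Properties.CommutativeSemigroup as CommSemigroupProperties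
open import Algebra.Solver.Ring.AlmostCommutativeRing
import Algebra.Solver.Ring as RingSolver
import Relation.Binary.Reasoning.Setoid as SetoidReasoning


module RingTools {c ℓ} (R : CommutativeRing c ℓ) where
  open CommutativeRing R
  open RingProperties ring public
  open SetoidReasoning setoid public
  open SemiringMult semiring using (_×_; ×-homo-+; ×1-homo-*; 1+×)
  open CommSemigroupProperties *-commutativeSemigroup public
    using (x∙yz≈y∙xz; xy∙z≈y∙xz; xy∙z≈xz∙y) renaming (interchange to *-interchange)
  open CommSemigroupProperties +-commutativeSemigroup public using () renaming (interchange to +-interchange)

  natR≈×1 : ∀ n → natR R n ≈ n × 1#
  natR≈×1 zero    = refl
  natR≈×1 (suc n) = trans (+-congˡ (natR≈×1 n)) (sym (1+× n 1#))

  natR-+ : ∀ m n → natR R (m ℕ.+ n) ≈ natR R m + natR R n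
  natR-+ m n = trans (natR≈×1 (m ℕ.+ n)) (trans (×-homo-+ 1# m n) (sym (+-cong (natR≈×1 m) (natR≈×1 n))))

  natR-* : ∀ m n → natR R (m ℕ.* n) ≈ natR R m * natR R n
  natR-* m n = trans (natR≈×1 (m ℕ.* n)) (trans (×1-homo-* m n) (sym (*-cong (natR≈×1 m) (natR≈×1 n))))

  -- With the type-checking-optimised _×_, 0 × 1# and 1 × 1# reduce to 0# and 1#,
  -- so the solver constants con (+ 0) and con (+ 1) are 0# and 1# on the nose.
  intR : ℤ → Carrier
  intR (+ n)    = n × 1#
  intR -[1+ n ] = - (suc n × 1#)

  1+x-[1+y]≈x-y : ∀ x y → (1# + x) - (1# + y) ≈ x - y
  1+x-[1+y]≈x-y x y = begin
    (1# + x) + - (1# + y)    ≈⟨ +-congˡ (sym (-‿+-comm 1# y)) ⟩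
    (1# + x) + (- 1# + - y)  ≈⟨ +-congʳ (+-comm 1# x) ⟩
    (x + 1#) + (- 1# + - y)  ≈⟨ +-assoc x 1# _ ⟩
    x + (1# + (- 1# + - y))  ≈⟨ +-congˡ (sym (+-assoc 1# (- 1#) (- y))) ⟩
    x + ((1# - 1#) + - y)    ≈⟨ +-congˡ (+-congʳ (-‿inverseʳ 1#)) ⟩
    x + (0# + - y)           ≈⟨ +-congˡ (+-identityˡ (- y)) ⟩
    x - y                    ∎

  intR-⊖ : ∀ m n → intR (m ℤ.⊖ n) ≈ m × 1# - n × 1#
  intR-⊖ zero    zero    = sym (-‿inverseʳ 0#)
  intR-⊖ zero    (suc n) = sym (+-identityˡ _)
  intR-⊖ (suc m) zero    = sym (trans (+-congˡ -0#≈0#) (+-identityʳ _))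
  intR-⊖ (suc m) (suc n) = begin
    intR (suc m ℤ.⊖ suc n)              ≡⟨ P.cong intR (ℤP.[1+m]⊖[1+n]≡m⊖n m n) ⟩
    intR (m ℤ.⊖ n)                      ≈⟨ intR-⊖ m n ⟩
    m × 1# - n × 1#                     ≈⟨ sym (1+x-[1+y]≈x-y _ _) ⟩
    (1# + m × 1#) - (1# + n × 1#)       ≈⟨ sym (+-cong (1+× m 1#) (-‿cong (1+× n 1#))) ⟩
    suc m × 1# - suc n × 1#             ∎

  intR-+ : ∀ i j → intR (i ℤ.+ j) ≈ intR i + intR j
  intR-+ (+ m)    (+ n)    = ×-homo-+ 1# m n
  intR-+ (+ m)    -[1+ n ] = intR-⊖ m (suc n)
  intR-+ -[1+ m ] (+ n)    = trans (intR-⊖ n (suc m)) (+-comm _ _)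
  intR-+ -[1+ m ] -[1+ n ] = begin
    - (suc (suc (m ℕ.+ n)) × 1#)                 ≈⟨ -‿cong (1+× (suc (m ℕ.+ n)) 1#) ⟩
    - (1# + suc (m ℕ.+ n) × 1#)                  ≈⟨ -‿cong (+-congˡ (×-homo-+ 1# (suc m) n)) ⟩
    - (1# + (suc m × 1# + n × 1#))               ≈⟨ -‿cong (x∙yz≈y∙xz′ 1# _ _) ⟩
    - (suc m × 1# + (1# + n × 1#))               ≈⟨ -‿cong (+-congˡ (sym (1+× n 1#))) ⟩
    - (suc m × 1# + suc n × 1#)                  ≈⟨ sym (-‿+-comm _ _) ⟩
    - (suc m × 1#) + - (suc n × 1#)              ∎
    where open CommSemigroupProperties +-commutativeSemigroup using () renaming (x∙yz≈y∙xz to x∙yz≈y∙xz′)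

  signR : Sign → Carrier
  signR Sign.+ = 1#
  signR Sign.- = - 1#

  signR-* : ∀ s t → signR (s Sign.* t) ≈ signR s * signR t
  signR-* Sign.- Sign.- = sym (trans (-1*x≈-x (- 1#)) (-‿involutive 1#))
  signR-* Sign.- Sign.+ = sym (*-identityʳ _)
  signR-* Sign.+ Sign.- = sym (*-identityˡ _)
  signR-* Sign.+ Sign.+ = sym (*-identityˡ _)

  intR-◃ : ∀ s n → intR (s ℤ.◃ n) ≈ signR s * (n × 1#)
  intR-◃ Sign.- zero    = sym (zeroʳ _)
  intR-◃ Sign.+ zero    = sym (zeroʳ _)
  intR-◃ Sign.+ (suc n) = sym (*-identityˡ _)
  intR-◃ Sign.- (suc n) = sym (-1*x≈-x _)

  intR-signAbs : ∀ i → intR i ≈ signR (ℤ.sign i) * (ℤ.∣ i ∣ × 1#)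
  intR-signAbs i = begin
    intR i                                ≡⟨ P.cong intR (P.sym (ℤP.◃-inverse i)) ⟩
    intR (ℤ.sign i ℤ.◃ ℤ.∣ i ∣)            ≈⟨ intR-◃ (ℤ.sign i) ℤ.∣ i ∣ ⟩
    signR (ℤ.sign i) * (ℤ.∣ i ∣ × 1#)     ∎

  intR-* : ∀ i j → intR (i ℤ.* j) ≈ intR i * intR j
  intR-* i j = begin
    intR (i ℤ.* j)                              ≈⟨ intR-◃ (ℤ.sign i Sign.* ℤ.sign j) (ℤ.∣ i ∣ ℕ.* ℤ.∣ j ∣) ⟩
    signR (ℤ.sign i Sign.* ℤ.sign j) * ((ℤ.∣ i ∣ ℕ.* ℤ.∣ j ∣) × 1#)
      ≈⟨ *-cong (signR-* (ℤ.sign i) (ℤ.sign j)) (×1-homo-* ℤ.∣ i ∣ ℤ.∣ j ∣) ⟩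
    (si * sj) * (ai * aj)                       ≈⟨ *-interchange si sj ai aj ⟩
    (si * ai) * (sj * aj)                       ≈⟨ sym (*-cong (intR-signAbs i) (intR-signAbs j)) ⟩
    intR i * intR j                             ∎
    where
    si = signR (ℤ.sign i)
    sj = signR (ℤ.sign j)
    ai = ℤ.∣ i ∣ × 1#
    aj = ℤ.∣ j ∣ × 1#

  intR-neg : ∀ i → intR (ℤ.- i) ≈ - intR i
  intR-neg (+ zero)  = sym -0#≈0#
  intR-neg (+ suc n) = refl
  intR-neg -[1+ n ]  = sym (-‿involutive _)

  intR-homomorphism : CommutativeRing.rawRing ℤP.+-*-commutativeRing -Raw-AlmostCommutative⟶ fromCommutativeRing R
  intR-homomorphism = record
    { ⟦_⟧    = intR
    ; +-homo = intR-+
    ; *-homo = intR-*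
    ; -‿homo = intR-neg
    ; 0-homo = refl
    ; 1-homo = refl
    }

  intR-≟ : ∀ i j → Maybe (intR i ≈ intR j)
  intR-≟ i j with i ℤ.≟ j
  ... | yes P.refl = just refl
  ... | no _       = nothing

  module Solver = RingSolver (CommutativeRing.rawRing ℤP.+-*-commutativeRing) (fromCommutativeRing R) intR-homomorphism intR-≟


module Sums {c ℓ} (F : CharZeroField c ℓ) where
  open Degenerate F hiding (zero)
  open RingTools cring

  sumBelow-cong-< : ∀ n {f g : ℕ → Carrier} → (∀ i → i < n → f i ≈ g i) → sumBelow n f ≈ sumBelow n g
  sumBelow-cong-< zero    f≈g = refl
  sumBelow-cong-< (suc n) f≈g = +-cong (sumBelow-cong-< n (λ i i<n → f≈g i (ℕP.m<n⇒m<1+n i<n))) (f≈g n ℕP.≤-refl)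

  sumBelow-cong : ∀ n {f g : ℕ → Carrier} → (∀ i → f i ≈ g i) → sumBelow n f ≈ sumBelow n g
  sumBelow-cong n f≈g = sumBelow-cong-< n (λ i _ → f≈g i)

  sumBelow-+ : ∀ n (f g : ℕ → Carrier) → sumBelow n (λ i → f i + g i) ≈ sumBelow n f + sumBelow n g
  sumBelow-+ zero    f g = sym (+-identityˡ 0#)
  sumBelow-+ (suc n) f g = trans (+-congʳ (sumBelow-+ n f g)) (+-interchange _ _ _ _)

  *-distribˡ-sumBelow : ∀ n a (f : ℕ → Carrier) → a * sumBelow n f ≈ sumBelow n (λ i → a * f i)
  *-distribˡ-sumBelow zero    a f = zeroʳ a
  *-distribˡ-sumBelow (suc n) a f = trans (distribˡ a _ _) (+-congʳ (*-distribˡ-sumBelow n a f))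

  sumBelow-zero : ∀ n {f : ℕ → Carrier} → (∀ i → i < n → f i ≈ 0#) → sumBelow n f ≈ 0#
  sumBelow-zero zero    f≈0 = refl
  sumBelow-zero (suc n) f≈0 =
    trans (+-cong (sumBelow-zero n (λ i i<n → f≈0 i (ℕP.m<n⇒m<1+n i<n))) (f≈0 n ℕP.≤-refl)) (+-identityˡ 0#)

  sumBelow-suc : ∀ n (f : ℕ → Carrier) → sumBelow (suc n) f ≈ f 0 + sumBelow n (λ i → f (suc i))
  sumBelow-suc zero    f = trans (+-identityˡ _) (sym (+-identityʳ _))
  sumBelow-suc (suc n) f = trans (+-congʳ (sumBelow-suc n f)) (+-assoc _ _ _)

  sumBelow-last : ∀ n {f : ℕ → Carrier} → (∀ i → i < n → f i ≈ 0#) → sumBelow (suc n) f ≈ f n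
  sumBelow-last n f≈0 = trans (+-congʳ (sumBelow-zero n f≈0)) (+-identityˡ _)

  sumBelow-extend : ∀ {a b} {f : ℕ → Carrier} → a ≤ b → (∀ i → a ≤ i → i < b → f i ≈ 0#) →
                    sumBelow b f ≈ sumBelow a f
  sumBelow-extend {b = zero}  z≤n f≈0 = refl
  sumBelow-extend {b = suc b} a≤1+b f≈0 with ℕP.m≤n⇒m<n∨m≡n a≤1+b
  ... | inj₁ (s≤s a≤b) = trans (+-cong (sumBelow-extend a≤b (λ i a≤i i<b → f≈0 i a≤i (ℕP.m<n⇒m<1+n i<b)))
                                       (f≈0 b a≤b ℕP.≤-refl))
                               (+-identityʳ _)
  ... | inj₂ P.refl    = refl

  sumBelow-reverse : ∀ n (f : ℕ → Carrier) → sumBelow n f ≈ sumBelow n (λ i → f (n ∸ suc i))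
  sumBelow-reverse zero    f = refl
  sumBelow-reverse (suc n) f = begin
    sumBelow n f + f n                                ≈⟨ +-comm _ _ ⟩
    f n + sumBelow n f                                ≈⟨ +-congˡ (sumBelow-reverse n f) ⟩
    f n + sumBelow n (λ i → f (n ∸ suc i))            ≈⟨ sym (sumBelow-suc n (λ i → f (n ∸ i))) ⟩
    sumBelow (suc n) (λ i → f (suc n ∸ suc i))        ∎

  sumBelow-swap : ∀ n m (f : ℕ → ℕ → Carrier) →
    sumBelow n (λ i → sumBelow m (f i)) ≈ sumBelow m (λ j → sumBelow n (λ i → f i j))
  sumBelow-swap zero    m f = sym (sumBelow-zero m (λ _ _ → refl))
  sumBelow-swap (suc n) m f = trans (+-congʳ (sumBelow-swap n m f)) (sym (sumBelow-+ m _ _))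


module FieldFacts {c ℓ} (F : CharZeroField c ℓ) where
  open Degenerate F hiding (zero)
  open RingTools cring

  1≉0 : ¬ (1# ≈ 0#)
  1≉0 1≈0 = char0 0 (trans (+-identityʳ 1#) 1≈0)

  inv-l : ∀ a → ¬ (a ≈ 0#) → inv a * a ≈ 1#
  inv-l a a≉0 = trans (*-comm _ _) (inv-r a a≉0)

  *-cancelˡ : ∀ a {x y} → ¬ (a ≈ 0#) → a * x ≈ a * y → x ≈ y
  *-cancelˡ a {x} {y} a≉0 ax≈ay = begin
    x                ≈⟨ sym (*-identityˡ x) ⟩
    1# * x           ≈⟨ *-congʳ (sym (inv-l a a≉0)) ⟩
    (inv a * a) * x  ≈⟨ *-assoc _ _ _ ⟩
    inv a * (a * x)  ≈⟨ *-congˡ ax≈ay ⟩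
    inv a * (a * y)  ≈⟨ sym (*-assoc _ _ _) ⟩
    (inv a * a) * y  ≈⟨ *-congʳ (inv-l a a≉0) ⟩
    1# * y           ≈⟨ *-identityˡ y ⟩
    y                ∎

  inv-unique : ∀ a {y} → ¬ (a ≈ 0#) → a * y ≈ 1# → y ≈ inv a
  inv-unique a a≉0 ay≈1 = *-cancelˡ a a≉0 (trans ay≈1 (sym (inv-r a a≉0)))

  *-nonzero : ∀ {a b} → ¬ (a ≈ 0#) → ¬ (b ≈ 0#) → ¬ (a * b ≈ 0#)
  *-nonzero {a} {b} a≉0 b≉0 ab≈0 = b≉0 (*-cancelˡ a a≉0 (trans ab≈0 (sym (zeroʳ a))))

  inv-nonzero : ∀ {a} → ¬ (a ≈ 0#) → ¬ (inv a ≈ 0#)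
  inv-nonzero {a} a≉0 inv≈0 = 1≉0 (trans (sym (inv-r a a≉0)) (trans (*-congˡ inv≈0) (zeroʳ a)))

  ^-nonzero : ∀ {a} m → ¬ (a ≈ 0#) → ¬ (a ^ m ≈ 0#)
  ^-nonzero zero    a≉0 = 1≉0
  ^-nonzero (suc m) a≉0 = *-nonzero a≉0 (^-nonzero m a≉0)

  ^ℤ-nonzero : ∀ {a} k → ¬ (a ≈ 0#) → ¬ (a ^ℤ k ≈ 0#)
  ^ℤ-nonzero (+ m)    a≉0 = ^-nonzero m a≉0
  ^ℤ-nonzero -[1+ m ] a≉0 = ^-nonzero (suc m) (inv-nonzero a≉0)

  ^ℤ-pred : ∀ {a} k → ¬ (a ≈ 0#) → (a ^ℤ (k ℤ.- ℤ.1ℤ)) * a ≈ a ^ℤ k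
  ^ℤ-pred {a} (+ zero)  a≉0 = trans (*-congʳ (*-identityʳ _)) (inv-l a a≉0)
  ^ℤ-pred {a} (+ suc m) a≉0 = *-comm _ _
  ^ℤ-pred {a} -[1+ m ]  a≉0 = begin
    (a ^ℤ -[1+ suc (m ℕ.+ 0) ]) * a       ≡⟨ P.cong (λ j → (inv a ^ suc (suc j)) * a) (ℕP.+-identityʳ m) ⟩
    (inv a * (inv a * (inv a ^ m))) * a   ≈⟨ xy∙z≈xz∙y _ _ _ ⟩
    (inv a * a) * (inv a * (inv a ^ m))   ≈⟨ *-congʳ (inv-l a a≉0) ⟩
    1# * (inv a * (inv a ^ m))            ≈⟨ *-identityˡ _ ⟩
    a ^ℤ -[1+ m ]                         ∎

  *-inv-^ℤ-pred : ∀ {a} b k → ¬ (a ≈ 0#) → ¬ (b ≈ 0#) → (a * b) * inv (b * (a ^ℤ k)) ≈ inv (a ^ℤ (k ℤ.- ℤ.1ℤ))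
  *-inv-^ℤ-pred {a} b k a≉0 b≉0 = inv-unique (a ^ℤ (k ℤ.- ℤ.1ℤ)) (^ℤ-nonzero (k ℤ.- ℤ.1ℤ) a≉0) (begin
    a′ * ((a * b) * inv (b * (a ^ℤ k)))   ≈⟨ sym (*-assoc _ _ _) ⟩
    (a′ * (a * b)) * inv (b * (a ^ℤ k))   ≈⟨ *-congʳ (trans (sym (*-assoc _ _ _)) (*-comm _ _)) ⟩
    (b * (a′ * a)) * inv (b * (a ^ℤ k))   ≈⟨ *-congʳ (*-congˡ (^ℤ-pred k a≉0)) ⟩
    (b * (a ^ℤ k)) * inv (b * (a ^ℤ k))   ≈⟨ inv-r _ (*-nonzero b≉0 (^ℤ-nonzero k a≉0)) ⟩
    1#                                    ∎)
    where
    a′ = a ^ℤ (k ℤ.- ℤ.1ℤ)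

  fact-nonzero : ∀ n → ¬ (fact n ≈ 0#)
  fact-nonzero n = P.subst (λ k → ¬ (ι k ≈ 0#)) (ℕP.suc-pred (n ℕ.!) {{ℕP._!≢0 n}}) (char0 (ℕ.pred (n ℕ.!)))

  fact-suc : ∀ n → fact (suc n) ≈ ι (suc n) * fact n
  fact-suc n = natR-* (suc n) (n ℕ.!)

  invFact : ℕ → Carrier
  invFact n = inv (fact n)

  fact*invFact : ∀ n → fact n * invFact n ≈ 1#
  fact*invFact n = inv-r (fact n) (fact-nonzero n)

  invFact-0 : invFact 0 ≈ 1#
  invFact-0 = sym (inv-unique (fact 0) (fact-nonzero 0) (trans (*-identityʳ _) (+-identityʳ 1#)))

  ι*invFact-suc : ∀ n → ι (suc n) * invFact (suc n) ≈ invFact n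
  ι*invFact-suc n = inv-unique (fact n) (fact-nonzero n) (begin
    fact n * (ι (suc n) * invFact (suc n))  ≈⟨ sym (*-assoc _ _ _) ⟩
    (fact n * ι (suc n)) * invFact (suc n)  ≈⟨ *-congʳ (trans (*-comm _ _) (sym (fact-suc n))) ⟩
    fact (suc n) * invFact (suc n)          ≈⟨ fact*invFact (suc n) ⟩
    1#                                      ∎)


module PowerSeries {c ℓ} (F : CharZeroField c ℓ) where
  open Degenerate F hiding (zero)
  open RingTools cring
  open Sums F
  open Solver using (solve; _:+_; _:*_; :-_; _:=_; con)

  infix  4 _≋_
  infixl 6 _⊕_
  infixr 7 _·_

  _≋_ : PS → PS → Set ℓ
  f ≋ g = ∀ n → f n ≈ g n

  _⊕_ : PS → PS → PS
  (f ⊕ g) n = f n + g n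

  _·_ : Carrier → PS → PS
  (a · f) n = a * f n

  ∂ : PS → PS
  ∂ f n = ι (suc n) * f (suc n)

  [1+_t]⊛_ : Carrier → PS → PS
  ([1+ μ t]⊛ f) zero    = f 0
  ([1+ μ t]⊛ f) (suc n) = f (suc n) + μ * f n

  ⊛-cong : ∀ {f f′ g g′} → f ≋ f′ → g ≋ g′ → f ⊛ g ≋ f′ ⊛ g′
  ⊛-cong f≋f′ g≋g′ n = sumBelow-cong (suc n) (λ i → *-cong (f≋f′ i) (g≋g′ (n ∸ i)))

  ⊛-comm : ∀ f g → f ⊛ g ≋ g ⊛ f
  ⊛-comm f g n = begin
    sumBelow (suc n) (λ i → f i * g (n ∸ i))              ≈⟨ sumBelow-reverse (suc n) _ ⟩
    sumBelow (suc n) (λ i → f (n ∸ i) * g (n ∸ (n ∸ i)))  ≈⟨ sumBelow-cong-< (suc n) reflect ⟩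
    sumBelow (suc n) (λ i → g i * f (n ∸ i))              ∎
    where
    reflect : ∀ i → i < suc n → f (n ∸ i) * g (n ∸ (n ∸ i)) ≈ g i * f (n ∸ i)
    reflect i i≤n rewrite ℕP.m∸[m∸n]≡n (ℕP.≤-pred i≤n) = *-comm _ _

  ⊛-distribʳ : ∀ f f′ g → (f ⊕ f′) ⊛ g ≋ f ⊛ g ⊕ f′ ⊛ g
  ⊛-distribʳ f f′ g n = trans (sumBelow-cong (suc n) (λ i → distribʳ _ _ _)) (sumBelow-+ (suc n) _ _)

  ·-⊛ : ∀ a f g → (a · f) ⊛ g ≋ a · (f ⊛ g)
  ·-⊛ a f g n = trans (sumBelow-cong (suc n) (λ i → *-assoc _ _ _)) (sym (*-distribˡ-sumBelow (suc n) a _))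

  oneS-⊛ : ∀ f → oneS ⊛ f ≋ f
  oneS-⊛ f n = begin
    (oneS ⊛ f) n                                            ≈⟨ sumBelow-suc n _ ⟩
    1# * f n + sumBelow n (λ i → 0# * f (n ∸ suc i))        ≈⟨ +-cong (*-identityˡ _) (sumBelow-zero n (λ _ _ → zeroˡ _)) ⟩
    f n + 0#                                                ≈⟨ +-identityʳ _ ⟩
    f n                                                     ∎

  ⊛-oneS : ∀ f → f ⊛ oneS ≋ f
  ⊛-oneS f n = trans (⊛-comm f oneS n) (oneS-⊛ f n)

  ∂-cong : ∀ {f g} → f ≋ g → ∂ f ≋ ∂ g
  ∂-cong f≋g n = *-congˡ (f≋g _)

  [1+t]⊛-cong : ∀ μ {f g} → f ≋ g → [1+ μ t]⊛ f ≋ [1+ μ t]⊛ g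
  [1+t]⊛-cong μ f≋g zero    = f≋g 0
  [1+t]⊛-cong μ f≋g (suc n) = +-cong (f≋g _) (*-congˡ (f≋g n))

  [1+t]⊛-⊕ : ∀ μ f g → [1+ μ t]⊛ (f ⊕ g) ≋ [1+ μ t]⊛ f ⊕ [1+ μ t]⊛ g
  [1+t]⊛-⊕ μ f g zero    = refl
  [1+t]⊛-⊕ μ f g (suc n) = trans (+-congˡ (distribˡ μ _ _)) (+-interchange _ _ _ _)

  [1+t]⊛-assocˡ : ∀ μ f g → [1+ μ t]⊛ (f ⊛ g) ≋ ([1+ μ t]⊛ f) ⊛ g
  [1+t]⊛-assocˡ μ f g zero    = refl
  [1+t]⊛-assocˡ μ f g (suc n) = sym (begin
    (([1+ μ t]⊛ f) ⊛ g) (suc n)                                       ≈⟨ sumBelow-suc (suc n) _ ⟩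
    f 0 * g (suc n) + sumBelow (suc n) (λ i → (f (suc i) + μ * f i) * g (n ∸ i))
      ≈⟨ +-congˡ (trans (sumBelow-cong (suc n) (λ i → trans (distribʳ _ _ _) (+-congˡ (*-assoc _ _ _))))
                        (sumBelow-+ (suc n) _ _)) ⟩
    f 0 * g (suc n) + (sumBelow (suc n) (λ i → f (suc i) * g (n ∸ i)) + sumBelow (suc n) (λ i → μ * (f i * g (n ∸ i))))
      ≈⟨ sym (+-assoc _ _ _) ⟩
    (f 0 * g (suc n) + sumBelow (suc n) (λ i → f (suc i) * g (n ∸ i))) + sumBelow (suc n) (λ i → μ * (f i * g (n ∸ i)))
      ≈⟨ +-cong (sym (sumBelow-suc (suc n) _)) (sym (*-distribˡ-sumBelow (suc n) μ _)) ⟩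
    ([1+ μ t]⊛ (f ⊛ g)) (suc n)                                       ∎)

  [1+t]⊛-assocʳ : ∀ μ f g → [1+ μ t]⊛ (f ⊛ g) ≋ f ⊛ ([1+ μ t]⊛ g)
  [1+t]⊛-assocʳ μ f g n = begin
    ([1+ μ t]⊛ (f ⊛ g)) n  ≈⟨ [1+t]⊛-cong μ (⊛-comm f g) n ⟩
    ([1+ μ t]⊛ (g ⊛ f)) n  ≈⟨ [1+t]⊛-assocˡ μ g f n ⟩
    (([1+ μ t]⊛ g) ⊛ f) n  ≈⟨ ⊛-comm _ f n ⟩
    (f ⊛ ([1+ μ t]⊛ g)) n  ∎

  ∂-⊛ : ∀ f g → ∂ (f ⊛ g) ≋ ∂ f ⊛ g ⊕ f ⊛ ∂ g
  ∂-⊛ f g n = begin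
    ι (suc n) * sumBelow (suc (suc n)) (λ i → h i)               ≈⟨ *-distribˡ-sumBelow (suc (suc n)) _ _ ⟩
    sumBelow (suc (suc n)) (λ i → ι (suc n) * h i)               ≈⟨ sumBelow-cong-< (suc (suc n)) split ⟩
    sumBelow (suc (suc n)) (λ i → ι i * h i + ι (suc n ∸ i) * h i) ≈⟨ sumBelow-+ (suc (suc n)) _ _ ⟩
    sumBelow (suc (suc n)) (λ i → ι i * h i) + sumBelow (suc (suc n)) (λ i → ι (suc n ∸ i) * h i)
                                                                   ≈⟨ +-cong weighted-left weighted-right ⟩
    (∂ f ⊛ g) n + (f ⊛ ∂ g) n                                      ∎
    where
    h : ℕ → Carrier
    h i = f i * g (suc n ∸ i)

    split : ∀ i → i < suc (suc n) → ι (suc n) * h i ≈ ι i * h i + ι (suc n ∸ i) * h i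
    split i i≤1+n = begin
      ι (suc n) * h i                        ≡⟨ P.cong (λ k → ι k * h i) (P.sym (ℕP.m+[n∸m]≡n (ℕP.≤-pred i≤1+n))) ⟩
      ι (i ℕ.+ (suc n ∸ i)) * h i            ≈⟨ *-congʳ (natR-+ i (suc n ∸ i)) ⟩
      (ι i + ι (suc n ∸ i)) * h i            ≈⟨ distribʳ _ _ _ ⟩
      ι i * h i + ι (suc n ∸ i) * h i        ∎

    weighted-left : sumBelow (suc (suc n)) (λ i → ι i * h i) ≈ (∂ f ⊛ g) n
    weighted-left = begin
      sumBelow (suc (suc n)) (λ i → ι i * h i)                           ≈⟨ sumBelow-suc (suc n) _ ⟩
      0# * h 0 + sumBelow (suc n) (λ i → ι (suc i) * (f (suc i) * g (n ∸ i)))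
                                                                         ≈⟨ trans (+-congʳ (zeroˡ _)) (+-identityˡ _) ⟩
      sumBelow (suc n) (λ i → ι (suc i) * (f (suc i) * g (n ∸ i)))       ≈⟨ sumBelow-cong (suc n) (λ i → sym (*-assoc _ _ _)) ⟩
      (∂ f ⊛ g) n                                                        ∎

    weighted-right : sumBelow (suc (suc n)) (λ i → ι (suc n ∸ i) * h i) ≈ (f ⊛ ∂ g) n
    weighted-right = begin
      sumBelow (suc n) (λ i → ι (suc n ∸ i) * h i) + ι (n ∸ n) * h (suc n)
        ≈⟨ +-cong (sumBelow-cong-< (suc n) (λ i i≤n → reflexive (P.cong (λ k → ι k * (f i * g k)) (ℕP.+-∸-assoc 1 (ℕP.≤-pred i≤n)))))
                  (trans (*-congʳ (reflexive (P.cong ι (ℕP.n∸n≡0 n)))) (zeroˡ _)) ⟩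
      sumBelow (suc n) (λ i → ι (suc (n ∸ i)) * (f i * g (suc (n ∸ i)))) + 0#
        ≈⟨ +-identityʳ _ ⟩
      sumBelow (suc n) (λ i → ι (suc (n ∸ i)) * (f i * g (suc (n ∸ i))))
        ≈⟨ sumBelow-cong (suc n) (λ i → x∙yz≈y∙xz _ _ _) ⟩
      (f ⊛ ∂ g) n ∎

  powS-vanishes-below : ∀ f → f 0 ≈ 0# → ∀ m n → n < m → powS f m n ≈ 0#
  powS-vanishes-below f f0≈0 (suc m) zero    _ = trans (+-identityˡ _) (trans (*-congʳ f0≈0) (zeroˡ _))
  powS-vanishes-below f f0≈0 (suc m) (suc n) (s≤s n<m) = sumBelow-zero (suc (suc n)) term≈0
    where
    term≈0 : ∀ i → i < suc (suc n) → f i * powS f m (suc n ∸ i) ≈ 0#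
    term≈0 zero    _ = trans (*-congʳ f0≈0) (zeroˡ _)
    term≈0 (suc i) _ = trans (*-congˡ (powS-vanishes-below f f0≈0 m (n ∸ i) (ℕP.<-≤-trans (s≤s (ℕP.m∸n≤m n i)) n<m)))
                             (zeroʳ _)

  powS-· : ∀ a f m → powS (a · f) m ≋ (a ^ m) · powS f m
  powS-· a f zero    n = sym (*-identityˡ _)
  powS-· a f (suc m) n = begin
    sumBelow (suc n) (λ i → (a * f i) * powS (a · f) m (n ∸ i))           ≈⟨ sumBelow-cong (suc n) (λ i → *-congˡ (powS-· a f m (n ∸ i))) ⟩
    sumBelow (suc n) (λ i → (a * f i) * ((a ^ m) * powS f m (n ∸ i)))      ≈⟨ sumBelow-cong (suc n) (λ i → *-interchange _ _ _ _) ⟩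
    sumBelow (suc n) (λ i → (a * (a ^ m)) * (f i * powS f m (n ∸ i)))      ≈⟨ sym (*-distribˡ-sumBelow (suc n) _ _) ⟩
    (a * (a ^ m)) * powS f (suc m) n                                       ∎

  powS-cong : ∀ {f g} m → f ≋ g → powS f m ≋ powS g m
  powS-cong zero    f≋g n = refl
  powS-cong (suc m) f≋g   = ⊛-cong f≋g (powS-cong m f≋g)

  prev : (ℕ → Carrier) → ℕ → Carrier
  prev f zero    = 0#
  prev f (suc l) = f l

  module PowersOfODESolution (E : PS) (μ α : Carrier) (E-ode : [1+ μ t]⊛ ∂ E ≋ oneS ⊕ α · E) where

    ∂-powS-suc : ∀ l → [1+ μ t]⊛ ∂ (powS E (suc l)) ≋ ι (suc l) · (powS E l ⊕ α · powS E (suc l))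
    ∂-powS-suc zero n = begin
      ([1+ μ t]⊛ ∂ (E ⊛ oneS)) n         ≈⟨ [1+t]⊛-cong μ (∂-cong (⊛-oneS E)) n ⟩
      ([1+ μ t]⊛ ∂ E) n                  ≈⟨ E-ode n ⟩
      oneS n + α * E n                   ≈⟨ +-congˡ (*-congˡ (sym (⊛-oneS E n))) ⟩
      oneS n + α * (E ⊛ oneS) n          ≈⟨ sym (trans (*-congʳ (+-identityʳ 1#)) (*-identityˡ _)) ⟩
      ι 1 * (oneS n + α * (E ⊛ oneS) n)  ∎
    ∂-powS-suc (suc l) n = begin
      ([1+ μ t]⊛ ∂ (E ⊛ Q)) n                                 ≈⟨ [1+t]⊛-cong μ (∂-⊛ E Q) n ⟩
      ([1+ μ t]⊛ (∂ E ⊛ Q ⊕ E ⊛ ∂ Q)) n                       ≈⟨ [1+t]⊛-⊕ μ _ _ n ⟩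
      ([1+ μ t]⊛ (∂ E ⊛ Q)) n + ([1+ μ t]⊛ (E ⊛ ∂ Q)) n      ≈⟨ +-cong ([1+t]⊛-assocˡ μ (∂ E) Q n) ([1+t]⊛-assocʳ μ E (∂ Q) n) ⟩
      (([1+ μ t]⊛ ∂ E) ⊛ Q) n + (E ⊛ ([1+ μ t]⊛ ∂ Q)) n
        ≈⟨ +-cong (⊛-cong {g = Q} E-ode (λ _ → refl) n) (⊛-cong {f = E} (λ _ → refl) (∂-powS-suc l) n) ⟩
      ((oneS ⊕ α · E) ⊛ Q) n + (E ⊛ (ι (suc l) · (powS E l ⊕ α · Q))) n
                                                              ≈⟨ +-cong first second ⟩
      (Q n + α * Q′ n) + ι (suc l) * (Q n + α * Q′ n)         ≈⟨ +-congʳ (sym (*-identityˡ _)) ⟩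
      1# * (Q n + α * Q′ n) + ι (suc l) * (Q n + α * Q′ n)    ≈⟨ sym (distribʳ _ _ _) ⟩
      ι (suc (suc l)) * (Q n + α * Q′ n)                      ∎
      where
      Q Q′ : PS
      Q  = powS E (suc l)
      Q′ = powS E (suc (suc l))

      first : ((oneS ⊕ α · E) ⊛ Q) n ≈ Q n + α * Q′ n
      first = trans (⊛-distribʳ oneS (α · E) Q n) (+-cong (oneS-⊛ Q n) (·-⊛ α E Q n))

      second : (E ⊛ (ι (suc l) · (powS E l ⊕ α · Q))) n ≈ ι (suc l) * (Q n + α * Q′ n)
      second = begin
        (E ⊛ (ι (suc l) · (powS E l ⊕ α · Q))) n         ≈⟨ ⊛-comm E _ n ⟩
        ((ι (suc l) · (powS E l ⊕ α · Q)) ⊛ E) n         ≈⟨ ·-⊛ (ι (suc l)) _ E n ⟩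
        ι (suc l) * ((powS E l ⊕ α · Q) ⊛ E) n           ≈⟨ *-congˡ (⊛-distribʳ (powS E l) (α · Q) E n) ⟩
        ι (suc l) * ((powS E l ⊛ E) n + ((α · Q) ⊛ E) n)
          ≈⟨ *-congˡ (+-cong (⊛-comm (powS E l) E n) (trans (·-⊛ α Q E n) (*-congˡ (⊛-comm Q E n)))) ⟩
        ι (suc l) * (Q n + α * Q′ n)                     ∎

    powS-coeff-recurrence : ∀ l n → ι (suc n) * powS E l (suc n) + μ * (ι n * powS E l n)
                                    ≈ ι l * (prev (λ j → powS E j n) l + α * powS E l n)
    powS-coeff-recurrence zero    zero    = trans (+-cong (zeroʳ _) (trans (*-congˡ (zeroˡ _)) (zeroʳ _)))
                                                  (trans (+-identityˡ 0#) (sym (zeroˡ _)))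
    powS-coeff-recurrence zero    (suc n) = trans (+-cong (zeroʳ _) (trans (*-congˡ (zeroʳ _)) (zeroʳ _)))
                                                  (trans (+-identityˡ 0#) (sym (zeroˡ _)))
    powS-coeff-recurrence (suc l) zero    =
      trans (trans (+-congˡ (trans (*-congˡ (zeroˡ _)) (zeroʳ _))) (+-identityʳ _)) (∂-powS-suc l 0)
    powS-coeff-recurrence (suc l) (suc n) = ∂-powS-suc l (suc n)

  negReflect : PS → PS
  negReflect f n = - (((- 1#) ^ n) * f n)

  negReflect-ode : ∀ {f μ α} → [1+ μ t]⊛ ∂ f ≋ oneS ⊕ α · f →
                   [1+ (- μ) t]⊛ ∂ (negReflect f) ≋ oneS ⊕ (- α) · negReflect f
  negReflect-ode {f} {μ} {α} f-ode zero = begin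
    ι 1 * - ((- 1# * 1#) * f 1)    ≈⟨ solve 2 (λ i a → i :* :- ((:- con (+ 1) :* con (+ 1)) :* a) := i :* a) refl _ _ ⟩
    ι 1 * f 1                      ≈⟨ f-ode 0 ⟩
    1# + α * f 0                   ≈⟨ solve 2 (λ α a → con (+ 1) :+ α :* a := con (+ 1) :+ (:- α) :* :- (con (+ 1) :* a)) refl _ _ ⟩
    1# + (- α) * - (1# * f 0)      ∎
  negReflect-ode {f} {μ} {α} f-ode (suc n) = begin
    ι (suc (suc n)) * - ((- 1# * (- 1# * s)) * f (suc (suc n))) + (- μ) * (ι (suc n) * - ((- 1# * s) * f (suc n)))
      ≈⟨ solve 6 (λ s i a μ j b → i :* :- ((:- con (+ 1) :* (:- con (+ 1) :* s)) :* a) :+ (:- μ) :* (j :* :- ((:- con (+ 1) :* s) :* b))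
                                   := :- s :* (i :* a :+ μ :* (j :* b))) refl _ _ _ _ _ _ ⟩
    - s * (ι (suc (suc n)) * f (suc (suc n)) + μ * (ι (suc n) * f (suc n)))
      ≈⟨ *-congˡ (f-ode (suc n)) ⟩
    - s * (0# + α * f (suc n))
      ≈⟨ solve 3 (λ s α b → :- s :* (con (+ 0) :+ α :* b) := con (+ 0) :+ (:- α) :* :- ((:- con (+ 1) :* s) :* b)) refl _ _ _ ⟩
    0# + (- α) * - ((- 1# * s) * f (suc n))  ∎
    where
    s = (- 1#) ^ n


module Inversion {c ℓ} (F : CharZeroField c ℓ) where
  open Degenerate F hiding (zero)
  open RingTools cring
  open Sums F
  open FieldFacts F using (*-cancelˡ)
  open PowerSeries F
  open Solver using (solve; _:+_; _:*_; :-_; _:=_; con)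

  δ : ℕ → ℕ → Carrier
  δ zero    zero    = 1#
  δ zero    (suc m) = 0#
  δ (suc n) zero    = 0#
  δ (suc n) (suc m) = δ n m

  δ-diag : ∀ n → δ n n ≈ 1#
  δ-diag zero    = refl
  δ-diag (suc n) = δ-diag n

  δ-< : ∀ {n m} → m < n → δ n m ≈ 0#
  δ-< {suc n} {zero}  _         = refl
  δ-< {suc n} {suc m} (s≤s m<n) = δ-< m<n

  *δ-swap : ∀ (h : ℕ → Carrier) n m → h m * δ n m ≈ h n * δ n m
  *δ-swap h zero    zero    = refl
  *δ-swap h zero    (suc m) = trans (zeroʳ _) (sym (zeroʳ _))
  *δ-swap h (suc n) zero    = trans (zeroʳ _) (sym (zeroʳ _))
  *δ-swap h (suc n) (suc m) = *δ-swap (λ i → h (suc i)) n m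

  sign : ℕ → ℕ → Carrier
  sign n l = (- 1#) ^ (n ∸ l)

  sign-suc : ∀ {n l} → l ≤ n → sign (suc n) l ≈ - sign n l
  sign-suc {n} {l} l≤n = trans (reflexive (P.cong ((- 1#) ^_) (ℕP.+-∸-assoc 1 l≤n))) (-1*x≈-x _)

  module InverseMatrices (lam : Carrier) (E g : PS)
    (E-ode : [1+ lam t]⊛ ∂ E ≋ oneS ⊕ 1# · E) (E0≈0 : E 0 ≈ 0#)
    (g-ode : [1+ (- 1#) t]⊛ ∂ g ≋ oneS ⊕ (- lam) · g) (g0≈0 : g 0 ≈ 0#) where

    p q : ℕ → ℕ → Carrier
    p n l = powS E l n
    q l m = powS g m l

    p-rec : ∀ l n → ι (suc n) * p (suc n) l + lam * (ι n * p n l) ≈ ι l * (prev (p n) l + 1# * p n l)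
    p-rec = PowersOfODESolution.powS-coeff-recurrence E lam 1# E-ode

    q-rec : ∀ m l → ι (suc l) * q (suc l) m + (- 1#) * (ι l * q l m) ≈ ι m * (prev (q l) m + (- lam) * q l m)
    q-rec = PowersOfODESolution.powS-coeff-recurrence g (- 1#) (- lam) g-ode

    U U′ : ℕ → ℕ → Carrier
    U  n m = sumBelow (suc n) (λ l → sign n l * (p n l * q l m))
    U′ n m = sumBelow (suc n) (λ l → sign n l * (p n l * prev (q l) m))

    module URecurrenceTerms (n m : ℕ) where

      T₁ T₂ : ℕ → Carrier
      T₁ l = sign (suc n) l * ((ι l * prev (p n) l) * q l m)
      T₂ l = sign (suc n) l * ((ι l * p n l - lam * (ι n * p n l)) * q l m)

      term-split : ∀ l → ι (suc n) * (sign (suc n) l * (p (suc n) l * q l m)) ≈ T₁ l + T₂ l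
      term-split l = begin
        ι (suc n) * (s * (p (suc n) l * q l m))       ≈⟨ x∙yz≈y∙xz _ _ _ ⟩
        s * (ι (suc n) * (p (suc n) l * q l m))       ≈⟨ *-congˡ (sym (*-assoc _ _ _)) ⟩
        s * ((ι (suc n) * p (suc n) l) * q l m)       ≈⟨ *-congˡ (*-congʳ solved) ⟩
        s * ((ι l * (prev (p n) l + 1# * p n l) - lam * (ι n * p n l)) * q l m)
                                                      ≈⟨ distribute _ _ _ _ _ _ _ ⟩
        T₁ l + T₂ l                                   ∎
        where
        s = sign (suc n) l
        solved : ι (suc n) * p (suc n) l ≈ ι l * (prev (p n) l + 1# * p n l) - lam * (ι n * p n l)
        solved = trans (solve 2 (λ a b → a := (a :+ b) :+ :- b) refl _ _) (+-congʳ (p-rec l n))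
        distribute : ∀ s i a b λ′ j c → s * ((i * (a + 1# * b) - λ′ * (j * b)) * c)
                                        ≈ s * ((i * a) * c) + s * ((i * b - λ′ * (j * b)) * c)
        distribute = solve 7 (λ s i a b λ′ j c → s :* ((i :* (a :+ con (+ 1) :* b) :+ :- (λ′ :* (j :* b))) :* c)
                                               := s :* ((i :* a) :* c) :+ s :* ((i :* b :+ :- (λ′ :* (j :* b))) :* c)) refl

      T₁-zero : T₁ 0 ≈ 0#
      T₁-zero = trans (*-congˡ (trans (*-congʳ (zeroˡ _)) (zeroˡ _))) (zeroʳ _)

      T₂-last : T₂ (suc n) ≈ 0#
      T₂-last = begin
        T₂ (suc n)                                  ≈⟨ *-congˡ (*-congʳ (+-cong (*-congˡ p≈0) (-‿cong (*-congˡ (*-congˡ p≈0))))) ⟩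
        sign (suc n) (suc n) * ((ι (suc n) * 0# - lam * (ι n * 0#)) * q (suc n) m)
                                                    ≈⟨ vanish _ _ _ _ _ ⟩
        0#                                          ∎
        where
        p≈0 = powS-vanishes-below E E0≈0 (suc n) n ℕP.≤-refl
        vanish : ∀ s i λ′ j c → s * ((i * 0# - λ′ * (j * 0#)) * c) ≈ 0#
        vanish = solve 5 (λ s i λ′ j c → s :* ((i :* con (+ 0) :+ :- (λ′ :* (j :* con (+ 0)))) :* c) := con (+ 0)) refl

      adjacent-terms : ∀ l → l < suc n →
        T₁ (suc l) + T₂ l ≈ ι m * (sign n l * (p n l * prev (q l) m)) + (lam * (ι n - ι m)) * (sign n l * (p n l * q l m))
      adjacent-terms l l≤n = begin
        s * ((ι (suc l) * p n l) * q (suc l) m) + sign (suc n) l * ((ι l * p n l - lam * (ι n * p n l)) * q l m)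
          ≈⟨ +-cong (*-congˡ (xy∙z≈y∙xz _ _ _)) (*-congʳ (sign-suc (ℕP.≤-pred l≤n))) ⟩
        s * (p n l * (ι (suc l) * q (suc l) m)) + (- s) * ((ι l * p n l - lam * (ι n * p n l)) * q l m)
          ≈⟨ +-congʳ (*-congˡ (*-congˡ solved)) ⟩
        s * (p n l * (ι l * q l m + ι m * (prev (q l) m + (- lam) * q l m)))
          + (- s) * ((ι l * p n l - lam * (ι n * p n l)) * q l m)
          ≈⟨ collect _ _ _ _ _ _ _ _ ⟩
        ι m * (s * (p n l * prev (q l) m)) + (lam * (ι n - ι m)) * (s * (p n l * q l m)) ∎
        where
        s = sign n l
        solved : ι (suc l) * q (suc l) m ≈ ι l * q l m + ι m * (prev (q l) m + (- lam) * q l m)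
        solved = begin
          ι (suc l) * q (suc l) m                                   ≈⟨ solve 2 (λ a b → a := b :+ (a :+ :- b)) refl _ _ ⟩
          ι l * q l m + (ι (suc l) * q (suc l) m - ι l * q l m)     ≈⟨ +-congˡ (+-congˡ (sym (-1*x≈-x _))) ⟩
          ι l * q l m + (ι (suc l) * q (suc l) m + (- 1#) * (ι l * q l m))
                                                                    ≈⟨ +-congˡ (q-rec m l) ⟩
          ι l * q l m + ι m * (prev (q l) m + (- lam) * q l m)      ∎
        collect : ∀ s a i c k b λ′ j → s * (a * (i * c + k * (b + (- λ′) * c))) + (- s) * ((i * a - λ′ * (j * a)) * c)
                                      ≈ k * (s * (a * b)) + (λ′ * (j - k)) * (s * (a * c))
        collect = solve 8 (λ s a i c k b λ′ j →
            s :* (a :* (i :* c :+ k :* (b :+ (:- λ′) :* c))) :+ (:- s) :* ((i :* a :+ :- (λ′ :* (j :* a))) :* c)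
          := k :* (s :* (a :* b)) :+ (λ′ :* (j :+ :- k)) :* (s :* (a :* c))) refl

    U-recurrence : ∀ n m → ι (suc n) * U (suc n) m ≈ ι m * U′ n m + (lam * (ι n - ι m)) * U n m
    U-recurrence n m = begin
      ι (suc n) * U (suc n) m                               ≈⟨ *-distribˡ-sumBelow (suc (suc n)) _ _ ⟩
      sumBelow (suc (suc n)) (λ l → ι (suc n) * (sign (suc n) l * (p (suc n) l * q l m)))
                                                            ≈⟨ sumBelow-cong (suc (suc n)) term-split ⟩
      sumBelow (suc (suc n)) (λ l → T₁ l + T₂ l)            ≈⟨ sumBelow-+ (suc (suc n)) T₁ T₂ ⟩
      sumBelow (suc (suc n)) T₁ + sumBelow (suc (suc n)) T₂ ≈⟨ +-congʳ (sumBelow-suc (suc n) T₁) ⟩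
      (T₁ 0 + sumBelow (suc n) (λ l → T₁ (suc l))) + (sumBelow (suc n) T₂ + T₂ (suc n))
        ≈⟨ +-cong (trans (+-congʳ T₁-zero) (+-identityˡ _)) (trans (+-congˡ T₂-last) (+-identityʳ _)) ⟩
      sumBelow (suc n) (λ l → T₁ (suc l)) + sumBelow (suc n) T₂
                                                            ≈⟨ sym (sumBelow-+ (suc n) _ _) ⟩
      sumBelow (suc n) (λ l → T₁ (suc l) + T₂ l)            ≈⟨ sumBelow-cong-< (suc n) adjacent-terms ⟩
      sumBelow (suc n) (λ l → ι m * (sign n l * (p n l * prev (q l) m)) + κ * (sign n l * (p n l * q l m)))
                                                            ≈⟨ sumBelow-+ (suc n) _ _ ⟩
      sumBelow (suc n) (λ l → ι m * (sign n l * (p n l * prev (q l) m))) + sumBelow (suc n) (λ l → κ * (sign n l * (p n l * q l m)))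
                                                            ≈⟨ sym (+-cong (*-distribˡ-sumBelow (suc n) _ _) (*-distribˡ-sumBelow (suc n) _ _)) ⟩
      ι m * U′ n m + κ * U n m                              ∎
      where
      open URecurrenceTerms n m
      κ = lam * (ι n - ι m)

    q-vanishes : ∀ {l m} → l < m → q l m ≈ 0#
    q-vanishes {l} {m} = powS-vanishes-below g g0≈0 m l

    q-top : ∀ m → q 0 m ≈ δ 0 m
    q-top zero    = refl
    q-top (suc m) = q-vanishes {0} {suc m} (s≤s z≤n)

    U≈δ : ∀ n m → U n m ≈ δ n m
    U≈δ zero    m = trans (+-identityˡ _) (trans (*-identityˡ _) (trans (*-identityˡ _) (q-top m)))
    U≈δ (suc n) m = *-cancelˡ (ι (suc n)) (char0 n) (trans (U-recurrence n m) (recurrence-δ m))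
      where
      κU≈0 : ∀ m → (lam * (ι n - ι m)) * U n m ≈ 0#
      κU≈0 m = begin
        (lam * (ι n - ι m)) * U n m             ≈⟨ trans (*-congˡ (U≈δ n m)) (*-assoc _ _ _) ⟩
        lam * ((ι n - ι m) * δ n m)             ≈⟨ *-congˡ (distribʳ _ _ _) ⟩
        lam * (ι n * δ n m + - ι m * δ n m)     ≈⟨ *-congˡ (+-congˡ (sym (-‿distribˡ-* _ _))) ⟩
        lam * (ι n * δ n m - ι m * δ n m)       ≈⟨ *-congˡ (+-congˡ (-‿cong (*δ-swap ι n m))) ⟩
        lam * (ι n * δ n m - ι n * δ n m)       ≈⟨ *-congˡ (-‿inverseʳ _) ⟩
        lam * 0#                                ≈⟨ zeroʳ lam ⟩
        0#                                      ∎

      recurrence-δ : ∀ m → ι m * U′ n m + (lam * (ι n - ι m)) * U n m ≈ ι (suc n) * δ (suc n) m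
      recurrence-δ zero    = trans (+-cong (zeroˡ _) (κU≈0 0)) (trans (+-identityˡ _) (sym (zeroʳ _)))
      recurrence-δ (suc m) = trans (+-cong (*-congˡ (U≈δ n m)) (κU≈0 (suc m)))
                                   (trans (+-identityʳ _) (*δ-swap (λ i → ι (suc i)) n m))


module DegenerateSeries {c ℓ} (F : CharZeroField c ℓ) where
  open Degenerate F hiding (zero)
  open RingTools cring
  open FieldFacts F
  open PowerSeries F
  open Solver using (solve; _:+_; _:*_; :-_; _:=_; con)

  ι*-invFact-suc : ∀ n a → ι (suc n) * (a * invFact (suc n)) ≈ a * invFact n
  ι*-invFact-suc n a = trans (x∙yz≈y∙xz _ _ _) (*-congˡ (ι*invFact-suc n))

  ff-one : ∀ x μ → ff x μ 1 ≈ x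
  ff-one = solve 2 (λ x μ → con (+ 1) :* (x :+ :- (con (+ 0) :* μ)) := x) refl

  eλ-1-ode : ∀ lam → [1+ lam t]⊛ ∂ (eλ-1 lam) ≋ oneS ⊕ 1# · eλ-1 lam
  eλ-1-ode lam zero = begin
    ι 1 * (ff 1# lam 1 * invFact 1)  ≈⟨ ι*-invFact-suc 0 _ ⟩
    ff 1# lam 1 * invFact 0          ≈⟨ *-cong (ff-one 1# lam) invFact-0 ⟩
    1# * 1#                          ≈⟨ solve 0 (con (+ 1) :* con (+ 1) := con (+ 1) :+ con (+ 1) :* con (+ 0)) refl ⟩
    1# + 1# * 0#                     ∎
  eλ-1-ode lam (suc n) = begin
    ι (suc (suc n)) * (Φ * (1# - ι (suc n) * lam) * invFact (suc (suc n))) + lam * (ι (suc n) * (Φ * invFact (suc n)))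
      ≈⟨ +-congʳ (ι*-invFact-suc (suc n) _) ⟩
    Φ * (1# - ι (suc n) * lam) * invFact (suc n) + lam * (ι (suc n) * (Φ * invFact (suc n)))
      ≈⟨ solve 4 (λ Φ i λ′ u → Φ :* (con (+ 1) :+ :- (i :* λ′)) :* u :+ λ′ :* (i :* (Φ :* u))
                               := con (+ 0) :+ con (+ 1) :* (Φ :* u)) refl _ _ _ _ ⟩
    0# + 1# * (Φ * invFact (suc n))  ∎
    where
    Φ = ff 1# lam (suc n)

  logλ1+-ode : ∀ {lam} → ¬ (lam ≈ 0#) → [1+ 1# t]⊛ ∂ (logλ1+ lam) ≋ oneS ⊕ lam · logλ1+ lam
  logλ1+-ode {lam} lam≉0 zero = begin
    ι 1 * (1# * (ff 1# (inv lam) 1 * invFact 1))  ≈⟨ x∙yz≈y∙xz _ _ _ ⟩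
    1# * (ι 1 * (ff 1# (inv lam) 1 * invFact 1))  ≈⟨ *-congˡ (ι*-invFact-suc 0 _) ⟩
    1# * (ff 1# (inv lam) 1 * invFact 0)          ≈⟨ *-congˡ (*-cong (ff-one 1# (inv lam)) invFact-0) ⟩
    1# * (1# * 1#)
      ≈⟨ solve 1 (λ λ′ → con (+ 1) :* (con (+ 1) :* con (+ 1)) := con (+ 1) :+ λ′ :* con (+ 0)) refl lam ⟩
    1# + lam * 0#                                 ∎
  logλ1+-ode {lam} lam≉0 (suc n) = begin
    ι (suc (suc n)) * ((lam * Λ) * (Φ * (1# - ι (suc n) * inv lam) * invFact (suc (suc n))))
      + 1# * (ι (suc n) * (Λ * (Φ * invFact (suc n))))
      ≈⟨ +-congʳ (trans (x∙yz≈y∙xz _ _ _) (*-congˡ (ι*-invFact-suc (suc n) _))) ⟩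
    (lam * Λ) * (Φ * (1# - ι (suc n) * inv lam) * invFact (suc n)) + 1# * (ι (suc n) * (Λ * (Φ * invFact (suc n))))
      ≈⟨ solve 6 (λ λ′ Λ Φ i λ⁻¹ u → (λ′ :* Λ) :* (Φ :* (con (+ 1) :+ :- (i :* λ⁻¹)) :* u) :+ con (+ 1) :* (i :* (Λ :* (Φ :* u)))
                  := λ′ :* (Λ :* (Φ :* u)) :+ (i :* (Λ :* (Φ :* u))) :* (con (+ 1) :+ :- (λ′ :* λ⁻¹))) refl _ _ _ _ _ _ ⟩
    lam * logλ1+ lam (suc n) + (ι (suc n) * logλ1+ lam (suc n)) * (1# - lam * inv lam)
      ≈⟨ +-congˡ (*-congˡ (+-congˡ (-‿cong (inv-r lam lam≉0)))) ⟩
    lam * logλ1+ lam (suc n) + (ι (suc n) * logλ1+ lam (suc n)) * (1# - 1#)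
      ≈⟨ solve 2 (λ a b → a :+ b :* (con (+ 1) :+ :- con (+ 1)) := con (+ 0) :+ a) refl _ _ ⟩
    0# + lam * logλ1+ lam (suc n)   ∎
    where
    Λ = lam ^ n
    Φ = ff 1# (inv lam) (suc n)


module Proof {c ℓ} (F : CharZeroField c ℓ) where
  open Degenerate F hiding (zero)
  open RingTools cring
  open Sums F
  open FieldFacts F
  open PowerSeries F
  open Inversion F
  open DegenerateSeries F
  open Solver using (solve; _:*_; _:=_)

  module _ (lam : Carrier) (lam≉0 : ¬ (lam ≈ 0#)) (k : ℤ) (x : Carrier) where
    open InverseMatrices lam (eλ-1 lam) (negReflect (logλ1+ lam)) (eλ-1-ode lam) refl
                   (negReflect-ode (logλ1+-ode lam≉0)) (trans (-‿cong (zeroʳ _)) -0#≈0#)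

    Li-term : ℕ → Carrier
    Li-term m = Li lam k m * (x ^ m)

    compose-Li-coeff : ∀ {N l} → l ≤ N →
      compose (Li lam k) (λ m → - (x * logλ1- lam m)) l ≈ sumBelow (suc N) (λ m → Li-term m * q l m)
    compose-Li-coeff {N} {l} l≤N = begin
      sumBelow (suc l) (λ m → Li lam k m * powS (λ i → - (x * logλ1- lam i)) m l)
        ≈⟨ sumBelow-cong (suc l) (λ m → *-congˡ (trans (powS-cong m (λ i → -‿distribʳ-* x _) l) (powS-· x _ m l))) ⟩
      sumBelow (suc l) (λ m → Li lam k m * ((x ^ m) * q l m))
        ≈⟨ sumBelow-cong (suc l) (λ m → sym (*-assoc _ _ _)) ⟩
      sumBelow (suc l) (λ m → Li-term m * q l m)
        ≈⟨ sym (sumBelow-extend (s≤s l≤N) (λ m l<m _ → trans (*-congˡ (q-vanishes l<m)) (zeroʳ _))) ⟩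
      sumBelow (suc N) (λ m → Li-term m * q l m)  ∎

    signed-term : ∀ {N l} → l ≤ N →
      sign N l * (bel lam k x l * S2 lam N l) ≈ fact N * sumBelow (suc N) (λ m → Li-term m * (sign N l * (p N l * q l m)))
    signed-term {N} {l} l≤N = begin
      sign N l * ((fact l * C) * (fact N * (p N l * invFact l)))   ≈⟨ *-congˡ (*-congʳ (*-congˡ (compose-Li-coeff l≤N))) ⟩
      sign N l * ((fact l * S) * (fact N * (p N l * invFact l)))   ≈⟨ regroup _ _ _ _ _ _ ⟩
      fact N * ((fact l * invFact l) * ((sign N l * p N l) * S))   ≈⟨ *-congˡ (trans (*-congʳ (fact*invFact l)) (*-identityˡ _)) ⟩
      fact N * ((sign N l * p N l) * S)                            ≈⟨ *-congˡ (*-distribˡ-sumBelow (suc N) _ _) ⟩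
      fact N * sumBelow (suc N) (λ m → (sign N l * p N l) * (Li-term m * q l m))
                                                                   ≈⟨ *-congˡ (sumBelow-cong (suc N) (λ m → regroup′ _ _ _ _)) ⟩
      fact N * sumBelow (suc N) (λ m → Li-term m * (sign N l * (p N l * q l m)))  ∎
      where
      C = compose (Li lam k) (λ m → - (x * logλ1- lam m)) l
      S = sumBelow (suc N) (λ m → Li-term m * q l m)
      regroup : ∀ σ f C f′ P u → σ * ((f * C) * (f′ * (P * u))) ≈ f′ * ((f * u) * ((σ * P) * C))
      regroup = solve 6 (λ σ f C f′ P u → σ :* ((f :* C) :* (f′ :* (P :* u))) := f′ :* ((f :* u) :* ((σ :* P) :* C))) refl
      regroup′ : ∀ σ P a q → (σ * P) * (a * q) ≈ a * (σ * (P * q))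
      regroup′ = solve 4 (λ σ P a q → (σ :* P) :* (a :* q) := a :* (σ :* (P :* q))) refl

    inversion-sum : ∀ N → sumBelow (suc N) (λ l → sign N l * (bel lam k x l * S2 lam N l)) ≈ fact N * Li-term N
    inversion-sum N = begin
      sumBelow (suc N) (λ l → sign N l * (bel lam k x l * S2 lam N l))
        ≈⟨ sumBelow-cong-< (suc N) (λ l l≤N → signed-term (ℕP.≤-pred l≤N)) ⟩
      sumBelow (suc N) (λ l → fact N * sumBelow (suc N) (λ m → Li-term m * (sign N l * (p N l * q l m))))
        ≈⟨ sym (*-distribˡ-sumBelow (suc N) _ _) ⟩
      fact N * sumBelow (suc N) (λ l → sumBelow (suc N) (λ m → Li-term m * (sign N l * (p N l * q l m))))
        ≈⟨ *-congˡ (sumBelow-swap (suc N) (suc N) _) ⟩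
      fact N * sumBelow (suc N) (λ m → sumBelow (suc N) (λ l → Li-term m * (sign N l * (p N l * q l m))))
        ≈⟨ *-congˡ (sumBelow-cong (suc N) (λ m → sym (*-distribˡ-sumBelow (suc N) (Li-term m) _))) ⟩
      fact N * sumBelow (suc N) (λ m → Li-term m * U N m)   ≈⟨ *-congˡ (sumBelow-cong (suc N) (λ m → *-congˡ (U≈δ N m))) ⟩
      fact N * sumBelow (suc N) (λ m → Li-term m * δ N m)
        ≈⟨ *-congˡ (sumBelow-last N (λ m m<N → trans (*-congˡ (δ-< m<N)) (zeroʳ _))) ⟩
      fact N * (Li-term N * δ N N)                          ≈⟨ *-congˡ (trans (*-congˡ (δ-diag N)) (*-identityʳ _)) ⟩
      fact N * Li-term N                                    ∎

    fact*Li-term : ∀ n → fact (suc n) * Li-term (suc n)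
                         ≈ (((- lam) ^ n) * ff 1# (inv lam) (suc n) / (ι (suc n) ^ℤ (k ℤ.- ℤ.1ℤ))) * (x ^ suc n)
    fact*Li-term n = begin
      fact (suc n) * ((σ * (Φ * inv (fact n * (a ^ℤ k)))) * (x ^ suc n))   ≈⟨ regroup _ _ _ _ _ ⟩
      (σ * (Φ * (fact (suc n) * inv (fact n * (a ^ℤ k))))) * (x ^ suc n)   ≈⟨ *-congʳ (*-congˡ (*-congˡ inv-factor)) ⟩
      (σ * (Φ * inv (a ^ℤ (k ℤ.- ℤ.1ℤ)))) * (x ^ suc n)                     ∎
      where
      σ = (- lam) ^ n
      Φ = ff 1# (inv lam) (suc n)
      a = ι (suc n)
      inv-factor : fact (suc n) * inv (fact n * (a ^ℤ k)) ≈ inv (a ^ℤ (k ℤ.- ℤ.1ℤ))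
      inv-factor = trans (*-congʳ (fact-suc n)) (*-inv-^ℤ-pred (fact n) k (char0 n) (fact-nonzero n))
      regroup : ∀ f σ Φ i y → f * ((σ * (Φ * i)) * y) ≈ (σ * (Φ * (f * i))) * y
      regroup = solve 5 (λ f σ Φ i y → f :* ((σ :* (Φ :* i)) :* y) := (σ :* (Φ :* (f :* i))) :* y) refl


theorem11 : ∀ {c ℓ : Level} (F : CharZeroField c ℓ) →
    let open Degenerate F in
    (lam : Carrier) → ¬ (lam ≈ 0#) → (k : ℤ) → (x : Carrier) →
    (n : ℕ) → 1 ≤ n →
    (((- lam) ^ (n ∸ 1)) * ff 1# (inv lam) n / (ι n ^ℤ (k ℤ.- ℤ.1ℤ))) * (x ^ n)
      ≈ sumBelow (suc n) (λ l → ((- 1#) ^ (n ∸ l)) * (bel lam k x l * S2 lam n l))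
theorem11 F lam lam≉0 k x zero    ()
theorem11 F lam lam≉0 k x (suc n) _ =
  trans (sym (fact*Li-term lam lam≉0 k x n)) (sym (inversion-sum lam lam≉0 k x (suc n)))
  where open Degenerate F using (trans; sym)
        open Proof F
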